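{- Let $G$ be a four-regular graph whose edge set is partitioned into two collections of cycles (two $2$-factors), let $v$ be a vertex of $G$, let $v_1,v_2$ be the neighbours of $v$ on its cycle in the first collection and $v_3,v_4$ its neighbours on its cycle in the second collection. Let $W$ be the graph with vertex set $\{v',x,x',v'',y,y',w,w_1,\dots,w_6,a,b\}$ (new vertices) consisting of the triangles $\{v',x,x'\}$, $\{v'',y,y'\}$, $\{w_1,w_2,w_3\}$, $\{w_4,w_5,w_6\}$ and the edges $xw_1, x'w, w_2w_5, w_3w_4, wa, w_6a, wb, w_1b, wy', w_6y$. Let $G'$ be obtained from $G$ by deleting $v$, adding $W$, and adding the edges $av_1, av_2, bv_3, bv_4$. Then for every integer $k$, $G$ has a vertex cover of size at most $k$ if and only if $G'$ has a vertex cover of size at most $k+9$.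
   Context: A vertex cover of a graph is a vertex set meeting every edge. -}

module Defs where

open import Data.Nat using (ℕ; suc)
open import Data.Integer using (ℤ; +_; _+_; _≤_)
open import Data.Fin using (Fin; punchIn)
open import Data.Sum using (_⊎_; inj₁; inj₂)
open import Data.Product using (Σ; _×_; ∃-syntax)
open import Data.List using (List; length)
open import Data.List.Membership.Propositional using (_∈_)
open import Data.List.Relation.Unary.Unique.Propositional using (Unique)
open import Relation.Binary.PropositionalEquality using (_≡_; _≢_)
open import Relation.Nullary using (¬_)
open import Function.Bundles using (_⇔_)

Symmetric : {V : Set} → (V → V → Set) → Set
Symmetric {V} E = ∀ (u w : V) → E u w → E w u

Irreflexive : {V : Set} → (V → V → Set) → Set
Irreflexive {V} E = ∀ (u : V) → ¬ E u u

SimpleGraph : {V : Set} → (V → V → Set) → Set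
SimpleGraph E = Symmetric E × Irreflexive E

Regular : {V : Set} → ℕ → (V → V → Set) → Set
Regular {V} d E =
  ∀ (u : V) → Σ (List V) λ ns →
    Unique ns × length ns ≡ d × (∀ (w : V) → (E u w ⇔ (w ∈ ns)))

EdgePartition : {V : Set} → (E F₁ F₂ : V → V → Set) → Set
EdgePartition {V} E F₁ F₂ =
  (∀ (u w : V) → (E u w ⇔ (F₁ u w ⊎ F₂ u w))) ×
  (∀ (u w : V) → ¬ (F₁ u w × F₂ u w))

-- A 2-factor of a simple graph: a spanning 2-regular (symmetric) subgraph,
-- i.e. a collection of vertex-disjoint cycles covering all vertices.
TwoFactor : {V : Set} → (F : V → V → Set) → Set
TwoFactor F = Symmetric F × Regular 2 F

HasVertexCoverOfSize≤ : {V : Set} → (V → V → Set) → ℤ → Set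
HasVertexCoverOfSize≤ {V} E k =
  ∃[ S ] (Unique {A = V} S × (+ length S) ≤ k ×
          (∀ (u w : V) → E u w → (u ∈ S ⊎ w ∈ S)))

data New : Set where
  v′ x x′ v″ y y′ w w₁ w₂ w₃ w₄ w₅ w₆ a b : New

-- The edges of W (each listed once; W is their symmetric closure).
data WEdge : New → New → Set where
  e-v′x : WEdge v′ x
  e-v′x′ : WEdge v′ x′
  e-xx′ : WEdge x x′
  e-v″y : WEdge v″ y
  e-v″y′ : WEdge v″ y′
  e-yy′ : WEdge y y′
  e-w₁w₂ : WEdge w₁ w₂
  e-w₁w₃ : WEdge w₁ w₃
  e-w₂w₃ : WEdge w₂ w₃
  e-w₄w₅ : WEdge w₄ w₅
  e-w₄w₆ : WEdge w₄ w₆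
  e-w₅w₆ : WEdge w₅ w₆
  e-xw₁ : WEdge x w₁
  e-x′w : WEdge x′ w
  e-w₂w₅ : WEdge w₂ w₅
  e-w₃w₄ : WEdge w₃ w₄
  e-wa : WEdge w a
  e-w₆a : WEdge w₆ a
  e-wb : WEdge w b
  e-w₁b : WEdge w₁ b
  e-wy′ : WEdge w y′
  e-w₆y : WEdge w₆ y

-- Vertices of G' : the vertices of G other than v (G has vertices Fin (suc m),
-- G - v has vertices Fin m, embedded via punchIn v), plus the new vertices.
V′ : ℕ → Set
V′ m = Fin m ⊎ New

data E′ {m : ℕ} (E : Fin (suc m) → Fin (suc m) → Set) (v v₁ v₂ v₃ v₄ : Fin (suc m))
        : V′ m → V′ m → Set where
  old   : ∀ {u t : Fin m} → E (punchIn v u) (punchIn v t) → E′ E v v₁ v₂ v₃ v₄ (inj₁ u) (inj₁ t)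
  new   : ∀ {p q : New} → WEdge p q → E′ E v v₁ v₂ v₃ v₄ (inj₂ p) (inj₂ q)
  new˘  : ∀ {p q : New} → WEdge p q → E′ E v v₁ v₂ v₃ v₄ (inj₂ q) (inj₂ p)
  att-a : ∀ {u : Fin m} → (punchIn v u ≡ v₁ ⊎ punchIn v u ≡ v₂) → E′ E v v₁ v₂ v₃ v₄ (inj₁ u) (inj₂ a)
  att-a˘ : ∀ {u : Fin m} → (punchIn v u ≡ v₁ ⊎ punchIn v u ≡ v₂) → E′ E v v₁ v₂ v₃ v₄ (inj₂ a) (inj₁ u)
  att-b : ∀ {u : Fin m} → (punchIn v u ≡ v₃ ⊎ punchIn v u ≡ v₄) → E′ E v v₁ v₂ v₃ v₄ (inj₁ u) (inj₂ b)
  att-b˘ : ∀ {u : Fin m} → (punchIn v u ≡ v₃ ⊎ punchIn v u ≡ v₄) → E′ E v v₁ v₂ v₃ v₄ (inj₂ b) (inj₁ u)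

module Submission where

open import Defs
open import Data.Nat using (ℕ; suc)
open import Data.Integer using (ℤ; +_; _+_)
open import Data.Fin using (Fin)
open import Data.Product using (_×_)
open import Function.Bundles using (_⇔_)
open import Relation.Binary.PropositionalEquality using (_≢_)

open import Level using (0ℓ)
open import Data.Nat using (_≤_; z≤n; s≤s) renaming (_+_ to _+ℕ_)
open import Data.Nat.Properties
  using (≤-trans; <⇒≤; +-suc; +-monoˡ-≤; +-monoʳ-≤) renaming (_≟_ to _≟ℕ_)
import Data.Integer as ℤ
import Data.Integer.Properties as ℤP
open import Data.Fin using (punchIn; punchOut)
open import Data.Fin.Properties
  using (punchIn-injective; punchInᵢ≢i; punchIn-punchOut; punchOut-punchIn; punchOut-cong)
  renaming (_≟_ to _≟ᶠ_)
open import Data.Product using (_,_; proj₁; proj₂)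
open import Data.Sum using (_⊎_; inj₁; inj₂; [_,_]; swap) renaming (map to map⊎)
open import Data.Empty using (⊥-elim)
open import Data.List using (List; []; _∷_; length; map; _++_; filter)
open import Data.List.Properties using (length-removeAt′; filter-accept; filter-reject; length-map; length-++)
open import Data.List.Relation.Unary.Any using (here; there; index; _─_; any?)
import Data.List.Relation.Unary.All as All
open import Data.List.Relation.Unary.AllPairs using ([]; _∷_)
open import Data.List.Relation.Unary.Unique.Propositional using (Unique)
import Data.List.Relation.Unary.Unique.Propositional.Properties as Unique
open import Data.List.Relation.Binary.Subset.Propositional using (_⊆_)
open import Data.List.Membership.Propositional using (_∈_; _∉_)
open import Data.List.Membership.Propositional.Properties using (∈-map⁺; ∈-map⁻; ∈-++⁺ˡ; ∈-++⁺ʳ; ∈-filter⁻)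
open import Relation.Binary.PropositionalEquality using (_≡_; refl; sym; trans; cong; cong₂; subst; subst₂)
open import Relation.Binary.Definitions using (DecidableEquality)
open import Relation.Nullary using (¬_; Dec; yes; no)
open import Relation.Nullary.Decidable using (True; toWitness; from-yes; via-injection; _⊎-dec_)
open import Relation.Unary using (Pred; Decidable)
open import Function using (_∘_; id)
open import Function.Bundles using (Equivalence; mk⇔; mk↣)

-- A cover of G′ splits into a list O of old vertices
-- covering G − v and a list N of gadget vertices covering W, such that every
-- attachment edge a vᵢ, b vⱼ is met (`GadgetCover`); conversely such a pair
-- joins to a cover of G′.  The gadget is analysed once: W has a cover W9 of
-- size 9 avoiding a and b and a cover W10 of size 10 containing both, while
-- every cover of W has at least 9 vertices (four disjoint triangles plus the
-- edge w a) and at least 10 if it contains a or b ({w, a, b} then behaves like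
-- a fifth triangle).
--   (⇒) From a cover S of G: if v ∈ S, take S − v with W10; otherwise all
--       neighbours v₁ … v₄ of v lie in S, and S with W9 works.
--   (⇐) From a cover T of G′: if a, b ∉ T, the attachment edges force
--       v₁ … v₄ into T and the old part of T covers G; otherwise T has at
--       least 10 gadget vertices and the old part plus v covers G.

IsCover : {V : Set} → (V → V → Set) → List V → Set
IsCover E S = ∀ u t → E u t → u ∈ S ⊎ t ∈ S

module _ {A : Set} where

  ∈-─ : ∀ {β γ : A} {ys} (p : β ∈ ys) → γ ∈ ys → γ ≢ β → γ ∈ (ys ─ p)
  ∈-─ (here refl) (here refl) γ≢β = ⊥-elim (γ≢β refl)
  ∈-─ (here _) (there γ∈ys) _ = γ∈ys
  ∈-─ (there _) (here refl) _ = here refl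
  ∈-─ (there p) (there γ∈ys) γ≢β = there (∈-─ p γ∈ys γ≢β)

  unique-⊆-length : ∀ {xs ys : List A} → Unique xs → xs ⊆ ys → length xs ≤ length ys
  unique-⊆-length {[]} _ _ = z≤n
  unique-⊆-length {β ∷ xs} {ys} (β∉xs ∷ uxs) xs⊆ys =
    subst (suc (length xs) ≤_) (sym (length-removeAt′ ys (index β∈ys)))
      (s≤s (unique-⊆-length uxs λ γ∈xs →
        ∈-─ β∈ys (xs⊆ys (there γ∈xs)) (All.lookup β∉xs γ∈xs ∘ sym)))
    where
    β∈ys : β ∈ ys
    β∈ys = xs⊆ys (here refl)

module Counting {A : Set} {P : Pred A 0ℓ} (P? : Decidable P) where

  count : List A → ℕ
  count xs = length (filter P? xs)

  count-yes : ∀ {n p xs} → P p → n ≤ count xs → suc n ≤ count (p ∷ xs)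
  count-yes {n} pp h = subst (λ ys → suc n ≤ length ys) (sym (filter-accept P? pp)) (s≤s h)

  count-∷ : ∀ {n p xs} → n ≤ count xs → n ≤ count (p ∷ xs)
  count-∷ {n} {p} {xs} h = by (P? p)
    where
    by : Dec (P p) → n ≤ count (p ∷ xs)
    by (yes pp) = <⇒≤ (count-yes pp h)
    by (no ¬pp) = subst (λ ys → n ≤ length ys) (sym (filter-reject P? ¬pp)) h

  edge-count : ∀ {n p q xs} → P p ⊎ P q → n ≤ count xs → suc n ≤ count (p ∷ q ∷ xs)
  edge-count (inj₁ pp) h = count-yes pp (count-∷ h)
  edge-count (inj₂ qq) h = count-∷ (count-yes qq h)

  triangle-count : ∀ {n p q r xs} → P p ⊎ P q → P p ⊎ P r → P q ⊎ P r →
                   n ≤ count xs → 2 +ℕ n ≤ count (p ∷ q ∷ r ∷ xs)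
  triangle-count (inj₁ pp) _ qr h = count-yes pp (edge-count qr h)
  triangle-count (inj₂ qq) (inj₁ pp) _ h = count-yes pp (count-yes qq (count-∷ h))
  triangle-count (inj₂ qq) (inj₂ rr) _ h = count-∷ (count-yes qq (count-yes rr h))

number : New → ℕ
number v′ = 0
number x = 1
number x′ = 2
number v″ = 3
number y = 4
number y′ = 5
number w = 6
number w₁ = 7
number w₂ = 8
number w₃ = 9
number w₄ = 10
number w₅ = 11
number w₆ = 12
number a = 13
number b = 14

unnumber : ℕ → New
unnumber 0 = v′
unnumber 1 = x
unnumber 2 = x′
unnumber 3 = v″
unnumber 4 = y
unnumber 5 = y′
unnumber 6 = w
unnumber 7 = w₁
unnumber 8 = w₂
unnumber 9 = w₃
unnumber 10 = w₄
unnumber 11 = w₅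
unnumber 12 = w₆
unnumber 13 = a
unnumber _ = b

unnumber-number : ∀ p → unnumber (number p) ≡ p
unnumber-number v′ = refl
unnumber-number x = refl
unnumber-number x′ = refl
unnumber-number v″ = refl
unnumber-number y = refl
unnumber-number y′ = refl
unnumber-number w = refl
unnumber-number w₁ = refl
unnumber-number w₂ = refl
unnumber-number w₃ = refl
unnumber-number w₄ = refl
unnumber-number w₅ = refl
unnumber-number w₆ = refl
unnumber-number a = refl
unnumber-number b = refl

number-injective : ∀ {p q} → number p ≡ number q → p ≡ q
number-injective {p} {q} eq =
  trans (sym (unnumber-number p)) (trans (cong unnumber eq) (unnumber-number q))

_≟_ : DecidableEquality New
_≟_ = via-injection (mk↣ number-injective) _≟ℕ_

open import Data.List.Membership.DecPropositional _≟_ using (_∈?_)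
open import Data.List.Relation.Unary.Unique.DecPropositional _≟_ using (unique?)

WCover : List New → Set
WCover N = ∀ {p q} → WEdge p q → p ∈ N ⊎ q ∈ N

-- Whether a concrete edge is covered by a concrete list is decided by computation.
decided : ∀ {N p q} {_ : True ((p ∈? N) ⊎-dec (q ∈? N))} → p ∈ N ⊎ q ∈ N
decided {_} {_} {_} {t} = toWitness t

W9 W10 : List New
W9 = w ∷ w₁ ∷ w₂ ∷ w₄ ∷ w₆ ∷ x ∷ x′ ∷ y ∷ y′ ∷ []
W10 = a ∷ b ∷ x ∷ x′ ∷ y ∷ y′ ∷ w₂ ∷ w₃ ∷ w₄ ∷ w₅ ∷ []

W9-W10-cover : ∀ {p q} → WEdge p q → (p ∈ W9 ⊎ q ∈ W9) × (p ∈ W10 ⊎ q ∈ W10)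
W9-W10-cover e-v′x = decided , decided
W9-W10-cover e-v′x′ = decided , decided
W9-W10-cover e-xx′ = decided , decided
W9-W10-cover e-v″y = decided , decided
W9-W10-cover e-v″y′ = decided , decided
W9-W10-cover e-yy′ = decided , decided
W9-W10-cover e-w₁w₂ = decided , decided
W9-W10-cover e-w₁w₃ = decided , decided
W9-W10-cover e-w₂w₃ = decided , decided
W9-W10-cover e-w₄w₅ = decided , decided
W9-W10-cover e-w₄w₆ = decided , decided
W9-W10-cover e-w₅w₆ = decided , decided
W9-W10-cover e-xw₁ = decided , decided
W9-W10-cover e-x′w = decided , decided
W9-W10-cover e-w₂w₅ = decided , decided
W9-W10-cover e-w₃w₄ = decided , decided
W9-W10-cover e-wa = decided , decided
W9-W10-cover e-w₆a = decided , decided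
W9-W10-cover e-wb = decided , decided
W9-W10-cover e-w₁b = decided , decided
W9-W10-cover e-wy′ = decided , decided
W9-W10-cover e-w₆y = decided , decided

W9-cover : WCover W9
W9-cover e = proj₁ (W9-W10-cover e)

W10-cover : WCover W10
W10-cover e = proj₂ (W9-W10-cover e)

-- All gadget vertices, grouped into four disjoint triangles and {w, a, b}.
gadgetVertices : List New
gadgetVertices = v′ ∷ x ∷ x′ ∷ v″ ∷ y ∷ y′ ∷ w₁ ∷ w₂ ∷ w₃ ∷ w₄ ∷ w₅ ∷ w₆ ∷ w ∷ a ∷ b ∷ []

module GadgetLowerBound {N : List New} (N-unique : Unique N) (N-cover : WCover N) where
  open Counting (_∈? N)

  count-≤ : count gadgetVertices ≤ length N
  count-≤ = unique-⊆-length (Unique.filter⁺ (_∈? N) (from-yes (unique? gadgetVertices)))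
                            (proj₂ ∘ ∈-filter⁻ (_∈? N))

  triangles : ∀ {n} → n ≤ count (w ∷ a ∷ b ∷ []) → 8 +ℕ n ≤ count gadgetVertices
  triangles h = triangle e-v′x e-v′x′ e-xx′ (triangle e-v″y e-v″y′ e-yy′
    (triangle e-w₁w₂ e-w₁w₃ e-w₂w₃ (triangle e-w₄w₅ e-w₄w₆ e-w₅w₆ h)))
    where
    triangle : ∀ {n p q r xs} → WEdge p q → WEdge p r → WEdge q r →
               n ≤ count xs → 2 +ℕ n ≤ count (p ∷ q ∷ r ∷ xs)
    triangle pq pr qr = triangle-count (N-cover pq) (N-cover pr) (N-cover qr)

  at-least-9 : 9 ≤ length N
  at-least-9 = ≤-trans (triangles (edge-count (N-cover e-wa) z≤n)) count-≤

  -- With a or b in N, the edges w a, w b make {w, a, b} a fifth "triangle".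
  at-least-10 : a ∈ N ⊎ b ∈ N → 10 ≤ length N
  at-least-10 a∨b = ≤-trans (triangles (triangle-count (N-cover e-wa) (N-cover e-wb) a∨b z≤n)) count-≤

module Parts {m : ℕ} where

  olds : List (V′ m) → List (Fin m)
  olds [] = []
  olds (inj₁ u ∷ T) = u ∷ olds T
  olds (inj₂ _ ∷ T) = olds T

  news : List (V′ m) → List New
  news [] = []
  news (inj₁ _ ∷ T) = news T
  news (inj₂ p ∷ T) = p ∷ news T

  parts-length : ∀ T → length (olds T) +ℕ length (news T) ≡ length T
  parts-length [] = refl
  parts-length (inj₁ u ∷ T) = cong suc (parts-length T)
  parts-length (inj₂ p ∷ T) = trans (+-suc (length (olds T)) (length (news T))) (cong suc (parts-length T))

  olds-∈ : ∀ {u T} → inj₁ u ∈ T → u ∈ olds T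
  olds-∈ {T = inj₁ _ ∷ _} (here refl) = here refl
  olds-∈ {T = inj₁ _ ∷ _} (there u∈T) = there (olds-∈ u∈T)
  olds-∈ {T = inj₂ _ ∷ _} (there u∈T) = olds-∈ u∈T

  olds-∈⁻ : ∀ {u T} → u ∈ olds T → inj₁ u ∈ T
  olds-∈⁻ {T = inj₁ _ ∷ _} (here refl) = here refl
  olds-∈⁻ {T = inj₁ _ ∷ _} (there u∈T) = there (olds-∈⁻ u∈T)
  olds-∈⁻ {T = inj₂ _ ∷ _} u∈T = there (olds-∈⁻ u∈T)

  news-∈ : ∀ {p T} → inj₂ p ∈ T → p ∈ news T
  news-∈ {T = inj₂ _ ∷ _} (here refl) = here refl
  news-∈ {T = inj₂ _ ∷ _} (there p∈T) = there (news-∈ p∈T)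
  news-∈ {T = inj₁ _ ∷ _} (there p∈T) = news-∈ p∈T

  news-∈⁻ : ∀ {p T} → p ∈ news T → inj₂ p ∈ T
  news-∈⁻ {T = inj₂ _ ∷ _} (here refl) = here refl
  news-∈⁻ {T = inj₂ _ ∷ _} (there p∈T) = there (news-∈⁻ p∈T)
  news-∈⁻ {T = inj₁ _ ∷ _} p∈T = there (news-∈⁻ p∈T)

  olds-unique : ∀ {T} → Unique T → Unique (olds T)
  olds-unique {[]} _ = []
  olds-unique {inj₁ _ ∷ _} (fresh ∷ uT) =
    All.tabulate (λ u∈ eq → All.lookup fresh (olds-∈⁻ u∈) (cong inj₁ eq)) ∷ olds-unique uT
  olds-unique {inj₂ _ ∷ _} (_ ∷ uT) = olds-unique uT

  news-unique : ∀ {T} → Unique T → Unique (news T)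
  news-unique {[]} _ = []
  news-unique {inj₂ _ ∷ _} (fresh ∷ uT) =
    All.tabulate (λ p∈ eq → All.lookup fresh (news-∈⁻ p∈) (cong inj₂ eq)) ∷ news-unique uT
  news-unique {inj₁ _ ∷ _} (_ ∷ uT) = news-unique uT

  olds-length : ∀ {c} T → c ≤ length (news T) → length (olds T) +ℕ c ≤ length T
  olds-length {c} T h = subst (length (olds T) +ℕ c ≤_) (parts-length T) (+-monoʳ-≤ (length (olds T)) h)

  join : List (Fin m) → List New → List (V′ m)
  join O N = map inj₁ O ++ map inj₂ N

  join-∈ˡ : ∀ {u O N} → u ∈ O → inj₁ u ∈ join O N
  join-∈ˡ = ∈-++⁺ˡ ∘ ∈-map⁺ inj₁

  join-∈ʳ : ∀ {p O N} → p ∈ N → inj₂ p ∈ join O N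
  join-∈ʳ {O = O} = ∈-++⁺ʳ (map inj₁ O) ∘ ∈-map⁺ inj₂

  join-unique : ∀ {O N} → Unique O → Unique N → Unique (join O N)
  join-unique {O} {N} uO uN = Unique.++⁺ (Unique.map⁺ inj₁-injective uO) (Unique.map⁺ inj₂-injective uN) disjoint
    where
    inj₁-injective : ∀ {u t : Fin m} → inj₁ {B = New} u ≡ inj₁ t → u ≡ t
    inj₁-injective refl = refl
    inj₂-injective : ∀ {p q : New} → inj₂ {A = Fin m} p ≡ inj₂ q → p ≡ q
    inj₂-injective refl = refl
    disjoint : ∀ {z} → ¬ (z ∈ map inj₁ O × z ∈ map inj₂ N)
    disjoint (z∈O , z∈N) with ∈-map⁻ inj₁ z∈O | ∈-map⁻ inj₂ z∈N
    ... | _ , _ , refl | _ , _ , ()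

  join-length : ∀ O N → length (join O N) ≡ length O +ℕ length N
  join-length O N =
    trans (length-++ (map inj₁ O)) (cong₂ _+ℕ_ (length-map inj₁ O) (length-map inj₂ N))

module DeleteVertex {m : ℕ} (v : Fin (suc m)) where

  _─v : (Fin (suc m) → Fin (suc m) → Set) → Fin m → Fin m → Set
  (E ─v) u t = E (punchIn v u) (punchIn v t)

  lift : List (Fin m) → List (Fin (suc m))
  lift = map (punchIn v)

  lift-length : ∀ O → length (lift O) ≡ length O
  lift-length = length-map (punchIn v)

  lift-unique : ∀ {O} → Unique O → Unique (lift O)
  lift-unique = Unique.map⁺ (punchIn-injective v _ _)

  v∉lift : ∀ {O z} → z ∈ lift O → v ≢ z
  v∉lift z∈ v≡z with ∈-map⁻ (punchIn v) z∈
  ... | u , _ , z≡ = punchInᵢ≢i v u (sym (trans v≡z z≡))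

  lift-∈ : ∀ {O t} (v≢t : v ≢ t) → punchOut v≢t ∈ O → t ∈ lift O
  lift-∈ v≢t u∈O = subst (_∈ _) (punchIn-punchOut v≢t) (∈-map⁺ (punchIn v) u∈O)

  strip : List (Fin (suc m)) → List (Fin m)
  strip [] = []
  strip (s ∷ S) with v ≟ᶠ s
  ... | yes _ = strip S
  ... | no v≢s = punchOut v≢s ∷ strip S

  strip-∈ : ∀ {u} S → punchIn v u ∈ S → u ∈ strip S
  strip-∈ {u} (s ∷ S) (here refl) with v ≟ᶠ punchIn v u
  ... | yes v≡ = ⊥-elim (punchInᵢ≢i v u (sym v≡))
  ... | no v≢ = here (sym (trans (punchOut-cong v refl) (punchOut-punchIn v)))
  strip-∈ (s ∷ S) (there u∈S) with v ≟ᶠ s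
  ... | yes _ = strip-∈ S u∈S
  ... | no _ = there (strip-∈ S u∈S)

  strip-∈⁻ : ∀ {u} S → u ∈ strip S → punchIn v u ∈ S
  strip-∈⁻ (s ∷ S) u∈ with v ≟ᶠ s
  strip-∈⁻ (s ∷ S) u∈ | yes _ = there (strip-∈⁻ S u∈)
  strip-∈⁻ (s ∷ S) (here u≡) | no v≢s = here (trans (cong (punchIn v) u≡) (punchIn-punchOut v≢s))
  strip-∈⁻ (s ∷ S) (there u∈) | no _ = there (strip-∈⁻ S u∈)

  strip-unique : ∀ {S} → Unique S → Unique (strip S)
  strip-unique {[]} _ = []
  strip-unique {s ∷ S} (fresh ∷ uS) with v ≟ᶠ s
  ... | yes _ = strip-unique uS
  ... | no v≢s = All.tabulate (λ u∈ eq → All.lookup fresh (strip-∈⁻ S u∈)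
                   (trans (sym (punchIn-punchOut v≢s)) (cong (punchIn v) eq))) ∷ strip-unique uS

  lift-strip-⊆ : ∀ S → lift (strip S) ⊆ S
  lift-strip-⊆ S z∈ with ∈-map⁻ (punchIn v) z∈
  ... | _ , u∈ , refl = strip-∈⁻ S u∈

  strip-length : ∀ {S} → Unique S → length (strip S) ≤ length S
  strip-length {S} uS =
    subst (_≤ length S) (lift-length (strip S)) (unique-⊆-length (lift-unique (strip-unique uS)) (lift-strip-⊆ S))

  strip-length-v : ∀ {S} → Unique S → v ∈ S → suc (length (strip S)) ≤ length S
  strip-length-v {S} uS v∈S = subst (λ l → suc l ≤ length S) (lift-length (strip S))
    (unique-⊆-length (All.tabulate v∉lift ∷ lift-unique (strip-unique uS))
                     λ { (here refl) → v∈S ; (there z∈) → lift-strip-⊆ S z∈ })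

  strip-cover : ∀ {E S} → IsCover E S → IsCover (E ─v) (strip S)
  strip-cover covS u t e = map⊎ (strip-∈ _) (strip-∈ _) (covS _ _ e)

  avoiding-v : ∀ {E O s t} → IsCover (E ─v) O → (v≢s : v ≢ s) → (v≢t : v ≢ t) →
               E s t → s ∈ lift O ⊎ t ∈ lift O
  avoiding-v {E} covO v≢s v≢t e = map⊎ (lift-∈ v≢s) (lift-∈ v≢t)
    (covO _ _ (subst₂ E (sym (punchIn-punchOut v≢s)) (sym (punchIn-punchOut v≢t)) e))

  lift-cover-with-v : ∀ {E O} → IsCover (E ─v) O → IsCover E (v ∷ lift O)
  lift-cover-with-v covO s t e with v ≟ᶠ s | v ≟ᶠ t
  ... | yes refl | _ = inj₁ (here refl)
  ... | no _ | yes refl = inj₂ (here refl)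
  ... | no v≢s | no v≢t = map⊎ there there (avoiding-v covO v≢s v≢t e)

  lift-cover : ∀ {E O} → Symmetric E → IsCover (E ─v) O →
               (∀ {t} → E v t → t ∈ lift O) → IsCover E (lift O)
  lift-cover symE covO nbrs s t e with v ≟ᶠ s | v ≟ᶠ t
  ... | yes refl | _ = inj₂ (nbrs e)
  ... | no _ | yes refl = inj₁ (nbrs (symE _ _ e))
  ... | no v≢s | no v≢t = avoiding-v covO v≢s v≢t e

budget-forward : ∀ c {s t} {k : ℤ} → t ≤ s +ℕ c → + s ℤ.≤ k → + t ℤ.≤ k + + c
budget-forward c t≤ s≤k = ℤP.≤-trans (ℤ.+≤+ t≤) (ℤP.+-monoˡ-≤ (+ c) s≤k)

budget-backward : ∀ c {s t} {k : ℤ} → s +ℕ c ≤ t → + t ℤ.≤ k + + c → + s ℤ.≤ k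
budget-backward c {s} {t} {k} s+c≤t t≤k+c =
  subst₂ ℤ._≤_ (cancel (+ s)) (cancel k) (ℤP.+-monoˡ-≤ (ℤ.- + c) (ℤP.≤-trans (ℤ.+≤+ s+c≤t) t≤k+c))
  where
  cancel : ∀ i → i + + c + ℤ.- + c ≡ i
  cancel i = trans (ℤP.+-assoc i (+ c) (ℤ.- + c)) (trans (cong (ℤ._+_ i) (ℤP.+-inverseʳ (+ c))) (ℤP.+-identityʳ i))

pair-members : ∀ {A : Set} {ns : List A} {t p q : A} →
               length ns ≡ 2 → t ∈ ns → p ∈ ns → q ∈ ns → p ≢ q → t ≡ p ⊎ t ≡ q
pair-members {ns = _ ∷ _ ∷ []} _ (here refl) (here refl) _ _ = inj₁ refl
pair-members {ns = _ ∷ _ ∷ []} _ (here refl) (there (here refl)) (here refl) _ = inj₂ refl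
pair-members {ns = _ ∷ _ ∷ []} _ (there (here refl)) (there (here refl)) _ _ = inj₁ refl
pair-members {ns = _ ∷ _ ∷ []} _ (there (here refl)) (here refl) (there (here refl)) _ = inj₂ refl
pair-members {ns = _ ∷ _ ∷ []} _ _ (here refl) (here refl) p≢q = ⊥-elim (p≢q refl)
pair-members {ns = _ ∷ _ ∷ []} _ _ (there (here refl)) (there (here refl)) p≢q = ⊥-elim (p≢q refl)

two-neighbours : ∀ {V : Set} {F : V → V → Set} → Regular 2 F →
                 ∀ {u p q t} → F u p → F u q → p ≢ q → F u t → t ≡ p ⊎ t ≡ q
two-neighbours reg {u} fp fq p≢q ft with reg u
... | _ , _ , len , adj =
  pair-members len (Equivalence.to (adj _) ft) (Equivalence.to (adj _) fp) (Equivalence.to (adj _) fq) p≢q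

module Reduction {m : ℕ} (E : Fin (suc m) → Fin (suc m) → Set) (v v₁ v₂ v₃ v₄ : Fin (suc m)) where
  open Parts {m}
  open DeleteVertex v

  G′ : V′ m → V′ m → Set
  G′ = E′ E v v₁ v₂ v₃ v₄

  AtA AtB : Fin m → Set
  AtA u = punchIn v u ≡ v₁ ⊎ punchIn v u ≡ v₂
  AtB u = punchIn v u ≡ v₃ ⊎ punchIn v u ≡ v₄

  record GadgetCover (O : List (Fin m)) (N : List New) : Set where
    field
      old-cover : IsCover (E ─v) O
      new-cover : WCover N
      at-a : ∀ {u} → AtA u → u ∈ O ⊎ a ∈ N
      at-b : ∀ {u} → AtB u → u ∈ O ⊎ b ∈ N

  join-cover : ∀ {O N} → GadgetCover O N → IsCover G′ (join O N)
  join-cover gc _ _ (old e) = map⊎ join-∈ˡ join-∈ˡ (GadgetCover.old-cover gc _ _ e)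
  join-cover gc _ _ (new e) = map⊎ join-∈ʳ join-∈ʳ (GadgetCover.new-cover gc e)
  join-cover gc _ _ (new˘ e) = swap (map⊎ join-∈ʳ join-∈ʳ (GadgetCover.new-cover gc e))
  join-cover gc _ _ (att-a h) = map⊎ join-∈ˡ join-∈ʳ (GadgetCover.at-a gc h)
  join-cover gc _ _ (att-a˘ h) = swap (map⊎ join-∈ˡ join-∈ʳ (GadgetCover.at-a gc h))
  join-cover gc _ _ (att-b h) = map⊎ join-∈ˡ join-∈ʳ (GadgetCover.at-b gc h)
  join-cover gc _ _ (att-b˘ h) = swap (map⊎ join-∈ˡ join-∈ʳ (GadgetCover.at-b gc h))

  split-cover : ∀ {T} → IsCover G′ T → GadgetCover (olds T) (news T)
  split-cover covT = record
    { old-cover = λ _ _ e → map⊎ olds-∈ olds-∈ (covT _ _ (old e))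
    ; new-cover = λ e → map⊎ news-∈ news-∈ (covT _ _ (new e))
    ; at-a = λ h → map⊎ olds-∈ news-∈ (covT _ _ (att-a h))
    ; at-b = λ h → map⊎ olds-∈ news-∈ (covT _ _ (att-b h))
    }

  gadget-cover-size : ∀ {O N k} → Unique O → Unique N → GadgetCover O N →
                      + (length O +ℕ length N) ℤ.≤ k → HasVertexCoverOfSize≤ G′ k
  gadget-cover-size {O} {N} uO uN gc size =
    join O N , join-unique uO uN , subst (λ l → + l ℤ.≤ _) (sym (join-length O N)) size , join-cover gc

  forward : E v v₁ → E v v₂ → E v v₃ → E v v₄ →
            ∀ k → HasVertexCoverOfSize≤ E k → HasVertexCoverOfSize≤ G′ (k + + 9)
  forward e₁ e₂ e₃ e₄ k (S , uS , |S|≤k , covS) with any? (v ≟ᶠ_) S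
  ... | yes v∈S = gadget-cover-size (strip-unique uS) (from-yes (unique? W10)) record
    { old-cover = strip-cover covS
    ; new-cover = W10-cover
    ; at-a = λ _ → inj₂ (here refl)
    ; at-b = λ _ → inj₂ (there (here refl))
    } (budget-forward 9 (subst (_≤ length S +ℕ 9) (sym (+-suc (length (strip S)) 9))
                                (+-monoˡ-≤ 9 (strip-length-v uS v∈S))) |S|≤k)
  ... | no v∉S = gadget-cover-size (strip-unique uS) (from-yes (unique? W9)) record
    { old-cover = strip-cover covS
    ; new-cover = W9-cover
    ; at-a = inj₁ ∘ attached e₁ e₂
    ; at-b = inj₁ ∘ attached e₃ e₄
    } (budget-forward 9 (+-monoˡ-≤ 9 (strip-length uS)) |S|≤k)
    where
    -- Without v in S, every neighbour of v is in S.
    attached : ∀ {p q u} → E v p → E v q → punchIn v u ≡ p ⊎ punchIn v u ≡ q → u ∈ strip S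
    attached ep eq h = strip-∈ S ([ ⊥-elim ∘ v∉S , id ] (covS v _ edge))
      where
      edge : E v _
      edge = [ (λ h → subst (E v) (sym h) ep) , (λ h → subst (E v) (sym h) eq) ] h

  backward-with-v : ∀ k {T} → Unique T → + length T ℤ.≤ k + + 9 → IsCover G′ T →
                    a ∈ news T ⊎ b ∈ news T → HasVertexCoverOfSize≤ E k
  backward-with-v k {T} uT |T|≤ covT a∨b =
    v ∷ lift (olds T) , All.tabulate v∉lift ∷ lift-unique (olds-unique uT) , size ,
    lift-cover-with-v (GadgetCover.old-cover (split-cover covT))
    where
    at-least-10 : 10 ≤ length (news T)
    at-least-10 = GadgetLowerBound.at-least-10 (news-unique uT) (GadgetCover.new-cover (split-cover covT)) a∨b
    size : + suc (length (lift (olds T))) ℤ.≤ k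
    size rewrite lift-length (olds T) =
      budget-backward 9 (subst (_≤ length T) (+-suc (length (olds T)) 9) (olds-length T at-least-10)) |T|≤

  -- If a cover T of G′ avoids a and b, the attachment edges force every
  -- neighbour of v into T, so its old part alone covers E.
  backward-without-v : Symmetric E → Irreflexive E →
                       (∀ {t} → E v t → (t ≡ v₁ ⊎ t ≡ v₂) ⊎ (t ≡ v₃ ⊎ t ≡ v₄)) →
                       ∀ k {T} → Unique T → + length T ℤ.≤ k + + 9 → IsCover G′ T →
                       a ∉ news T → b ∉ news T → HasVertexCoverOfSize≤ E k
  backward-without-v symE irrE nbrs k {T} uT |T|≤ covT a∉ b∉ =
    lift (olds T) , lift-unique (olds-unique uT) , size , lift-cover symE (GadgetCover.old-cover gc) neighbour-in
    where
    gc : GadgetCover (olds T) (news T)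
    gc = split-cover covT
    at-least-9 : 9 ≤ length (news T)
    at-least-9 = GadgetLowerBound.at-least-9 (news-unique uT) (GadgetCover.new-cover gc)
    size : + length (lift (olds T)) ℤ.≤ k
    size rewrite lift-length (olds T) = budget-backward 9 (olds-length T at-least-9) |T|≤
    neighbour-in : ∀ {t} → E v t → t ∈ lift (olds T)
    neighbour-in {t} e with v ≟ᶠ t
    ... | yes refl = ⊥-elim (irrE v e)
    ... | no v≢t = lift-∈ v≢t ([ old-or-absent a∉ ∘ GadgetCover.at-a gc ∘ preimage
                                , old-or-absent b∉ ∘ GadgetCover.at-b gc ∘ preimage ] (nbrs e))
      where
      preimage : ∀ {p q} → t ≡ p ⊎ t ≡ q → punchIn v (punchOut v≢t) ≡ p ⊎ punchIn v (punchOut v≢t) ≡ q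
      preimage = map⊎ (trans (punchIn-punchOut v≢t)) (trans (punchIn-punchOut v≢t))
      old-or-absent : ∀ {c} → c ∉ news T → punchOut v≢t ∈ olds T ⊎ c ∈ news T → punchOut v≢t ∈ olds T
      old-or-absent c∉ = [ id , ⊥-elim ∘ c∉ ]

  backward : Symmetric E → Irreflexive E →
             (∀ {t} → E v t → (t ≡ v₁ ⊎ t ≡ v₂) ⊎ (t ≡ v₃ ⊎ t ≡ v₄)) →
             ∀ k → HasVertexCoverOfSize≤ G′ (k + + 9) → HasVertexCoverOfSize≤ E k
  backward symE irrE nbrs k (T , uT , |T|≤ , covT) with a ∈? news T | b ∈? news T
  ... | yes a∈ | _ = backward-with-v k uT |T|≤ covT (inj₁ a∈)
  ... | no _ | yes b∈ = backward-with-v k uT |T|≤ covT (inj₂ b∈)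
  ... | no a∉ | no b∉ = backward-without-v symE irrE nbrs k uT |T|≤ covT a∉ b∉

mainTheorem8 : (m : ℕ) (E F₁ F₂ : Fin (suc m) → Fin (suc m) → Set) →
    SimpleGraph E → Regular 4 E →
    TwoFactor F₁ → TwoFactor F₂ → EdgePartition E F₁ F₂ →
    (v v₁ v₂ v₃ v₄ : Fin (suc m)) →
    F₁ v v₁ → F₁ v v₂ → v₁ ≢ v₂ →
    F₂ v v₃ → F₂ v v₄ → v₃ ≢ v₄ →
    (k : ℤ) →
    (HasVertexCoverOfSize≤ E k ⇔ HasVertexCoverOfSize≤ (E′ E v v₁ v₂ v₃ v₄) (k + + 9))
mainTheorem8 m E F₁ F₂ (symE , irrE) _ (_ , F₁-2-regular) (_ , F₂-2-regular) (E⇔F₁⊎F₂ , _)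
             v v₁ v₂ v₃ v₄ f₁ f₂ v₁≢v₂ f₃ f₄ v₃≢v₄ k =
  mk⇔ (forward (edge (inj₁ f₁)) (edge (inj₁ f₂)) (edge (inj₂ f₃)) (edge (inj₂ f₄)) k)
      (backward symE irrE neighbours k)
  where
  open Reduction E v v₁ v₂ v₃ v₄
  edge : ∀ {t} → F₁ v t ⊎ F₂ v t → E v t
  edge = Equivalence.from (E⇔F₁⊎F₂ v _)
  neighbours : ∀ {t} → E v t → (t ≡ v₁ ⊎ t ≡ v₂) ⊎ (t ≡ v₃ ⊎ t ≡ v₄)
  neighbours e = map⊎ (two-neighbours F₁-2-regular f₁ f₂ v₁≢v₂) (two-neighbours F₂-2-regular f₃ f₄ v₃≢v₄)
                      (Equivalence.to (E⇔F₁⊎F₂ v _) e)
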